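{- For every integer $r\ge0$, $C(\Delta(r+2))\le\left\lfloor\frac{2^{r+2}-1}{3}\right\rfloor$.
   Context: For a lattice polytope $P$, $C(P)$ is the maximal $\ell$ such that $P$ can be written as a Cayley polytope (Cayley sum) of $\ell$ lattice polytopes, where $P$ is a Cayley sum of $\ell$ lattice polytopes if it is unimodularly equivalent (within its affine hull and lattice) to $\mathrm{conv}(\bigcup_{i=1}^\ell \{e_i\}\times P_i)\subset\mathbb{R}^\ell\times\mathbb{R}^{m}$ for lattice polytopes $P_i\subset\mathbb{R}^m$, equivalently if some affine lattice projection maps $P$ onto a unimodular $(\ell-1)$-simplex. For a $d$-dimensional lattice simplex $\Delta$ with vertices $v_1,\dots,v_{d+1}$, $\Lambda_\Delta=\{x\in(\mathbb{R}/\mathbb{Z})^{d+1}:\sum_ix_iv_i\in\mathbb{Z}^d,\ \sum_ix_i\in\mathbb{Z}\}$. Let $M(k)$ be a $k\times(2^k-1)$ matrix whose columns are all vectors of $\{0,1/2\}^k\setminus\{0\}$, each once, and $B(k)\subset(\mathbb{R}/\mathbb{Z})^{2^k-1}$ the subgroup generated by its rows (the group of the $k$-dimensional binary simplex code). $\Delta(r+2)$ is a lattice simplex of dimension $2^{r+2}-2$ with $\Lambda_{\Delta(r+2)}=B(r+2)$ (unique up to unimodular equivalence); it has degree $2^r$. -}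

module Defs where

open import Data.Nat as ℕ using (ℕ; zero; suc)
open import Data.Nat.DivMod using (_/_; _%_)
open import Data.Integer as ℤ using (ℤ; +_)
open import Data.Rational as ℚ using (ℚ; 0ℚ; 1ℚ; ½; _+_; _*_; _-_; _≤_)
open import Data.Fin using (Fin; zero; suc; toℕ)
open import Data.Product using (_×_; ∃; ∃-syntax)
open import Data.Empty using (⊥)
open import Relation.Binary.PropositionalEquality using (_≡_)

Σℚ : ∀ {n} → (Fin n → ℚ) → ℚ
Σℚ {zero}  f = 0ℚ
Σℚ {suc n} f = f zero + Σℚ (λ i → f (suc i))

Σℤ : ∀ {n} → (Fin n → ℤ) → ℤ
Σℤ {zero}  f = + 0
Σℤ {suc n} f = f zero ℤ.+ Σℤ (λ i → f (suc i))

↑ : ℤ → ℚ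
↑ z = z ℚ./ 1

IsInt : ℚ → Set
IsInt q = ∃[ z ] q ≡ ↑ z

ConvQ : ∀ {n d} → (Fin n → Fin d → ℤ) → (Fin d → ℚ) → Set
ConvQ {n} v y =
  ∃ λ (t : Fin n → ℚ) → ((∀ i → 0ℚ ≤ t i) × (Σℚ t ≡ 1ℚ)
         × (∀ j → y j ≡ Σℚ (λ i → t i * ↑ (v i j))))

AffinelyIndependent : ∀ {n d} → (Fin n → Fin d → ℤ) → Set
AffinelyIndependent {n} v =
  (t : Fin n → ℚ) → Σℚ t ≡ 0ℚ → (∀ j → Σℚ (λ i → t i * ↑ (v i j)) ≡ 0ℚ) →
  ∀ i → t i ≡ 0ℚ

-- v is the vertex list of a lattice simplex (of dimension n-1; with
-- n = d+1 a full-dimensional d-simplex in ℤ^d).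
IsLatticeSimplex : ∀ {n d} → (Fin n → Fin d → ℤ) → Set
IsLatticeSimplex v = AffinelyIndependent v

-- Membership of x ∈ ℚ^n (read modulo ℤ^n) in Λ_Δ.
InΛ : ∀ {n d} → (Fin n → Fin d → ℤ) → (Fin n → ℚ) → Set
InΛ v x = (∀ j → IsInt (Σℚ (λ i → x i * ↑ (v i j)))) × IsInt (Σℚ x)

bit : ℕ → ℕ → ℕ
bit zero    m = m % 2
bit (suc j) m = bit j (m / 2)

-- M(k): column c (c = 0 … 2^k-2) is the vector (1/2)·(binary digits of c+1),
-- so the columns are exactly the elements of {0,1/2}^k \ {0}, each once.
M : (k : ℕ) → Fin k → Fin (2 ℕ.^ k ℕ.∸ 1) → ℚ
M k j c = (+ bit (toℕ j) (suc (toℕ c))) ℚ./ 2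

-- Membership of x (read modulo ℤ) in B(k), the subgroup of (ℝ/ℤ)^(2^k-1)
-- generated by the rows of M(k): x ≡ Σ_j a_j · row_j  (mod ℤ) for some a ∈ ℤ^k.
InB : (k : ℕ) → (Fin (2 ℕ.^ k ℕ.∸ 1) → ℚ) → Set
InB k x = ∃ λ (a : Fin k → ℤ) → (∀ c → IsInt (x c - Σℚ (λ j → ↑ (a j) * M k j c)))

δ : ∀ {m} → Fin m → Fin m → ℤ
δ zero    zero    = + 1
δ zero    (suc _) = + 0
δ (suc _) zero    = + 0
δ (suc i) (suc j) = δ i j

IsUnimodularSimplex : ∀ {m} → (Fin (suc m) → Fin m → ℤ) → Set
IsUnimodularSimplex {m} w =
  ∃ λ (V : Fin m → Fin m → ℤ) → ((∀ i k → Σℤ (λ j → U i j ℤ.* V j k) ≡ δ i k)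
        × (∀ i k → Σℤ (λ j → V i j ℤ.* U j k) ≡ δ i k))
  where
  U : Fin m → Fin m → ℤ
  U i j = w (suc j) i ℤ.- w zero i

affMap : ∀ {m d} → (Fin m → Fin d → ℤ) → (Fin m → ℤ) → (Fin d → ℚ) → Fin m → ℚ
affMap A b x i = ↑ (b i) + Σℚ (λ j → ↑ (A i j) * x j)

-- Some affine lattice projection ℤ^d → ℤ^m maps conv(v) onto a unimodular
-- m-simplex conv(w) (image equality tested on rational points).
ProjectsOntoUnimodularSimplex : ∀ {n d} → (Fin n → Fin d → ℤ) → (m : ℕ) → Set
ProjectsOntoUnimodularSimplex {n} {d} v m =
  ∃ λ (A : Fin m → Fin d → ℤ) → ∃ λ (b : Fin m → ℤ) →
  ∃ λ (w : Fin (suc m) → Fin m → ℤ) → (IsUnimodularSimplex w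
    × (∀ (y : Fin m → ℚ) →
         ((∃ λ (x : Fin d → ℚ) → (ConvQ v x × (∀ i → affMap A b x i ≡ y i))) → ConvQ w y)
       × (ConvQ w y → ∃ λ (x : Fin d → ℚ) → (ConvQ v x × (∀ i → affMap A b x i ≡ y i)))))

-- conv(v) is a Cayley sum of ℓ lattice polytopes
-- (iff it projects onto a unimodular (ℓ-1)-simplex).
IsCayleyOfLength : ∀ {n d} → (Fin n → Fin d → ℤ) → ℕ → Set
IsCayleyOfLength v zero    = ⊥
IsCayleyOfLength v (suc m) = ProjectsOntoUnimodularSimplex v m

-- A projection of Δ onto a unimodular (ℓ-1)-simplex pulls back the barycentric coordinates of that
-- simplex to affine functions with integer coefficients.
-- Evaluated at the vertices of Δ they are nonnegative integers summing to 1, so they split the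
-- vertices into ℓ nonempty parts, and for every x ∈ Λ_Δ the sum of the x_i over a part is an
-- integer. The rows of M(r+2) lie in B(r+2) = Λ_Δ, so the columns of M(r+2) belonging to one part
-- sum to 0 modulo ℤ. These columns are distinct and nonzero, hence no part has one or two
-- elements, and 3ℓ ≤ 2^(r+2) - 1.
module Submission where

import Algebra.Properties.Semiring.Sum as SemiringSum
import Data.Nat.Properties as ℕP

module ℕΣ = SemiringSum ℕP.+-*-semiring

module ColumnPartitions where

  open import Data.Empty using (⊥-elim)
  open import Data.Fin using (Fin; zero; suc; toℕ)
  import Data.Fin.Properties as FinP
  open import Data.Nat
  open import Data.Nat.Properties
  open import Data.Nat.DivMod
  open import Data.Nat.Divisibility using (_∣_; ∣⇒≤)
  open import Data.Product using (∃; ∃₂; _×_; _,_)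
  open import Function using (_∘_)
  open import Relation.Binary.PropositionalEquality
  open import Relation.Nullary using (¬_)

  open import Defs using (bit)
  open ℕΣ using (sum)

  bit≤1 : ∀ j n → bit j n ≤ 1
  bit≤1 zero    n = ≤-pred (m%n<n n 2)
  bit≤1 (suc j) n = bit≤1 j (n / 2)

  bit-zero : ∀ j → bit j 0 ≡ 0
  bit-zero zero    = refl
  bit-zero (suc j) = bit-zero j

  bits-injective : ∀ K {a b} → a < 2 ^ K → b < 2 ^ K →
    (∀ (j : Fin K) → bit (toℕ j) a ≡ bit (toℕ j) b) → a ≡ b
  bits-injective zero {zero}  {zero}  _           _           _ = refl
  bits-injective zero {suc _} {_}     (s≤s ())    _           _
  bits-injective zero {_}     {suc _} _           (s≤s ())    _
  bits-injective (suc K) {a} {b} a<2ᴷ⁺¹ b<2ᴷ⁺¹ same-bits = begin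
    a                   ≡⟨ m≡m%n+[m/n]*n a 2 ⟩
    a % 2 + a / 2 * 2   ≡⟨ cong₂ (λ r q → r + q * 2) (same-bits zero)
                             (bits-injective K (halve a<2ᴷ⁺¹) (halve b<2ᴷ⁺¹) (same-bits ∘ suc)) ⟩
    b % 2 + b / 2 * 2   ≡⟨ sym (m≡m%n+[m/n]*n b 2) ⟩
    b                   ∎
    where
    open ≡-Reasoning
    halve : ∀ {x} → x < 2 ^ suc K → x / 2 < 2 ^ K
    halve {x} x<2ᴷ⁺¹ = m<n*o⇒m/o<n (subst (x <_) (*-comm 2 (2 ^ K)) x<2ᴷ⁺¹)

  2∤1 : ¬ (2 ∣ 1)
  2∤1 2∣1 with ∣⇒≤ 2∣1
  ... | s≤s ()

  even-≤1⇒0 : ∀ {a} → a ≤ 1 → 2 ∣ a → a ≡ 0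
  even-≤1⇒0 z≤n       _   = refl
  even-≤1⇒0 (s≤s z≤n) 2∣1 = ⊥-elim (2∤1 2∣1)

  even-sum-≤1⇒≡ : ∀ {a b} → a ≤ 1 → b ≤ 1 → 2 ∣ a + b → a ≡ b
  even-sum-≤1⇒≡ z≤n       z≤n       _   = refl
  even-sum-≤1⇒≡ z≤n       (s≤s z≤n) 2∣1 = ⊥-elim (2∤1 2∣1)
  even-sum-≤1⇒≡ (s≤s z≤n) z≤n       2∣1 = ⊥-elim (2∤1 2∣1)
  even-sum-≤1⇒≡ (s≤s z≤n) (s≤s z≤n) _   = refl

  ≤-sum : ∀ {n} (f : Fin n → ℕ) i → f i ≤ sum f
  ≤-sum f zero    = m≤m+n (f zero) _
  ≤-sum f (suc i) = ≤-trans (≤-sum (f ∘ suc) i) (m≤n+m (sum (f ∘ suc)) (f zero))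

  sum-mono-≤ : ∀ {n} {f g : Fin n → ℕ} → (∀ i → f i ≤ g i) → sum f ≤ sum g
  sum-mono-≤ {zero}  f≤g = z≤n
  sum-mono-≤ {suc n} f≤g = +-mono-≤ (f≤g zero) (sum-mono-≤ (f≤g ∘ suc))

  sum-const : ∀ n c → sum {n} (λ _ → c) ≡ n * c
  sum-const zero    c = refl
  sum-const (suc n) c = cong (c +_) (sum-const n c)

  sum≡0⇒weighted≡0 : ∀ {n} (f : Fin n → ℕ) → sum f ≡ 0 → ∀ (g : Fin n → ℕ) → sum (λ i → g i * f i) ≡ 0
  sum≡0⇒weighted≡0 {zero}  f _    g = refl
  sum≡0⇒weighted≡0 {suc n} f Σf≡0 g with f zero | Σf≡0
  ... | 0 | Σf′≡0 = cong₂ _+_ (*-zeroʳ (g zero)) (sum≡0⇒weighted≡0 (f ∘ suc) Σf′≡0 (g ∘ suc))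

  sum≡1⇒singleton : ∀ {n} (f : Fin n → ℕ) → (∀ i → f i ≤ 1) → sum f ≡ 1 →
    ∃ λ a → ∀ (g : Fin n → ℕ) → sum (λ i → g i * f i) ≡ g a
  sum≡1⇒singleton {suc n} f f≤1 Σf≡1 with f zero | f≤1 zero | Σf≡1
  ... | 0 | _ | Σf′≡1 with sum≡1⇒singleton (f ∘ suc) (f≤1 ∘ suc) Σf′≡1
  ...   | a , pick = suc a , λ g → cong₂ _+_ (*-zeroʳ (g zero)) (pick (g ∘ suc))
  sum≡1⇒singleton {suc n} f f≤1 Σf≡1 | 1 | _ | Σf′≡0 = zero , λ g →
    trans (cong₂ _+_ (*-identityʳ (g zero)) (sum≡0⇒weighted≡0 (f ∘ suc) (suc-injective Σf′≡0) (g ∘ suc)))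
          (+-identityʳ (g zero))
  sum≡1⇒singleton {suc n} f f≤1 Σf≡1 | suc (suc _) | s≤s () | _

  sum≡2⇒pair : ∀ {n} (f : Fin n → ℕ) → (∀ i → f i ≤ 1) → sum f ≡ 2 →
    ∃₂ λ a b → a ≢ b × ∀ (g : Fin n → ℕ) → sum (λ i → g i * f i) ≡ g a + g b
  sum≡2⇒pair {suc n} f f≤1 Σf≡2 with f zero | f≤1 zero | Σf≡2
  ... | 0 | _ | Σf′≡2 with sum≡2⇒pair (f ∘ suc) (f≤1 ∘ suc) Σf′≡2
  ...   | a , b , a≢b , pick = suc a , suc b , a≢b ∘ FinP.suc-injective , λ g →
          cong₂ _+_ (*-zeroʳ (g zero)) (pick (g ∘ suc))
  sum≡2⇒pair {suc n} f f≤1 Σf≡2 | 1 | _ | Σf′≡1 with sum≡1⇒singleton (f ∘ suc) (f≤1 ∘ suc) (suc-injective Σf′≡1)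
  ...   | a , pick = zero , suc a , (λ ()) , λ g → cong₂ _+_ (*-identityʳ (g zero)) (pick (g ∘ suc))
  sum≡2⇒pair {suc n} f f≤1 Σf≡2 | suc (suc _) | s≤s () | _

  -- The columns of M(K) selected by f sum to 0 modulo ℤ (column c of 2·M(K) is the bit vector of c + 1).
  EvenColumnSums : ∀ {N} (K : ℕ) → (Fin N → ℕ) → Set
  EvenColumnSums K f = ∀ (j : Fin K) → 2 ∣ sum (λ c → bit (toℕ j) (suc (toℕ c)) * f c)

  module _ (K : ℕ) {N : ℕ} (N<2ᴷ : N < 2 ^ K) (f : Fin N → ℕ) (f≤1 : ∀ c → f c ≤ 1)
           (even : EvenColumnSums K f) where

    private
      column<2ᴷ : ∀ (c : Fin N) → suc (toℕ c) < 2 ^ K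
      column<2ᴷ c = ≤-trans (s≤s (FinP.toℕ<n c)) N<2ᴷ

      evenColumnSum-picked : ∀ (j : Fin K) {S} → sum (λ c → bit (toℕ j) (suc (toℕ c)) * f c) ≡ S → 2 ∣ S
      evenColumnSum-picked j eq = subst (2 ∣_) eq (even j)

    -- A single column of M(K) is nonzero, and two distinct columns differ.
    evenColumnSums⇒sum≢1 : sum f ≢ 1
    evenColumnSums⇒sum≢1 Σf≡1 with sum≡1⇒singleton f f≤1 Σf≡1
    ... | a , pick = 0≢1+n (bits-injective K (≤-trans (s≤s z≤n) (column<2ᴷ a)) (column<2ᴷ a) λ j →
      trans (bit-zero (toℕ j)) (sym (even-≤1⇒0 (bit≤1 (toℕ j) _)
        (evenColumnSum-picked j (pick (λ c → bit (toℕ j) (suc (toℕ c))))))))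

    evenColumnSums⇒sum≢2 : sum f ≢ 2
    evenColumnSums⇒sum≢2 Σf≡2 with sum≡2⇒pair f f≤1 Σf≡2
    ... | a , b , a≢b , pick = a≢b (FinP.toℕ-injective (suc-injective
      (bits-injective K (column<2ᴷ a) (column<2ᴷ b) λ j → even-sum-≤1⇒≡ (bit≤1 (toℕ j) _) (bit≤1 (toℕ j) _)
        (evenColumnSum-picked j (pick (λ c → bit (toℕ j) (suc (toℕ c))))))))

    evenColumnSums⇒3≤sum : ¬ (∀ c → f c ≡ 0) → 3 ≤ sum f
    evenColumnSums⇒3≤sum f≢0 with sum f in Σf≡
    ... | 0 = ⊥-elim (f≢0 (λ c → n≤0⇒n≡0 (subst (f c ≤_) Σf≡ (≤-sum f c))))
    ... | 1 = ⊥-elim (evenColumnSums⇒sum≢1 Σf≡)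
    ... | 2 = ⊥-elim (evenColumnSums⇒sum≢2 Σf≡)
    ... | suc (suc (suc _)) = s≤s (s≤s (s≤s z≤n))

  partition-size : ∀ {ℓ N} (part : Fin ℓ → Fin N → ℕ) → (∀ c → sum (λ k → part k c) ≡ 1) →
    (∀ k → 3 ≤ sum (part k)) → ℓ * 3 ≤ N
  partition-size {ℓ} {N} part covers 3≤part = begin
    ℓ * 3                                  ≡⟨ sum-const ℓ 3 ⟨
    sum {ℓ} (λ _ → 3)                      ≤⟨ sum-mono-≤ 3≤part ⟩
    sum (λ k → sum (part k))               ≡⟨ ℕΣ.∑-comm part ⟩
    sum (λ c → sum (λ k → part k c))       ≡⟨ ℕΣ.sum-cong-≗ covers ⟩
    sum {N} (λ _ → 1)                      ≡⟨ trans (sum-const N 1) (*-identityʳ N) ⟩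
    N                                      ∎
    where open ≤-Reasoning


module CayleyStructure where

  open import Algebra.Bundles using (CommutativeRing)
  open import Data.Fin using (Fin; zero; suc)
  open import Data.Integer as ℤ using (ℤ; +_)
  import Data.Integer.Properties as ℤP
  open import Data.Nat as ℕ using (ℕ)
  open import Data.Nat.Divisibility using (_∣_; divides)
  open import Data.Product using (_,_; proj₁; proj₂)
  open import Data.Rational as ℚ using (ℚ; 0ℚ; 1ℚ; _+_; _*_; -_; _-_)
  import Data.Rational.Properties as ℚP
  import Data.Rational.Unnormalised as ℚᵘ
  import Data.Rational.Unnormalised.Properties as ℚᵘP
  open import Data.Rational.Solver using (module +-*-Solver)
  open import Function using (_∘_)
  open import Relation.Binary.PropositionalEquality
  open import Relation.Nullary using (¬_)

  open import Defs

  module ℚΣ = SemiringSum (CommutativeRing.semiring ℚP.+-*-commutativeRing)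

  Σℚ≡sum : ∀ {n} (f : Fin n → ℚ) → Σℚ f ≡ ℚΣ.sum f
  Σℚ≡sum {ℕ.zero}  f = refl
  Σℚ≡sum {ℕ.suc n} f = cong (_+_ (f zero)) (Σℚ≡sum (f ∘ suc))

  Σℚ-cong : ∀ {n} {f g : Fin n → ℚ} → (∀ i → f i ≡ g i) → Σℚ f ≡ Σℚ g
  Σℚ-cong {f = f} {g} f≗g =
    trans (Σℚ≡sum f) (trans (ℚΣ.sum-cong-≗ {x = f} {g} f≗g) (sym (Σℚ≡sum g)))

  Σℚ-distrib-+ : ∀ {n} (f g : Fin n → ℚ) → Σℚ (λ i → f i + g i) ≡ Σℚ f + Σℚ g
  Σℚ-distrib-+ f g = begin
    Σℚ (λ i → f i + g i)    ≡⟨ Σℚ≡sum (λ i → f i + g i) ⟩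
    ℚΣ.sum (λ i → f i + g i) ≡⟨ ℚΣ.∑-distrib-+ f g ⟩
    ℚΣ.sum f + ℚΣ.sum g     ≡⟨ sym (cong₂ _+_ (Σℚ≡sum f) (Σℚ≡sum g)) ⟩
    Σℚ f + Σℚ g             ∎
    where open ≡-Reasoning

  *-distribˡ-Σℚ : ∀ {n} (a : ℚ) (f : Fin n → ℚ) → a * Σℚ f ≡ Σℚ (λ i → a * f i)
  *-distribˡ-Σℚ a f = begin
    a * Σℚ f               ≡⟨ cong (a *_) (Σℚ≡sum f) ⟩
    a * ℚΣ.sum f           ≡⟨ ℚΣ.*-distribˡ-sum a f ⟩
    ℚΣ.sum (λ i → a * f i) ≡⟨ sym (Σℚ≡sum (λ i → a * f i)) ⟩
    Σℚ (λ i → a * f i)     ∎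
    where open ≡-Reasoning

  Σℚ-zero : ∀ n → Σℚ {n} (λ _ → 0ℚ) ≡ 0ℚ
  Σℚ-zero n = trans (Σℚ≡sum {n} (λ _ → 0ℚ)) (ℚΣ.sum-replicate-zero n)

  Σℚ-comm : ∀ {m n} (f : Fin m → Fin n → ℚ) →
            Σℚ (λ i → Σℚ (f i)) ≡ Σℚ (λ j → Σℚ (λ i → f i j))
  Σℚ-comm f = begin
    Σℚ (λ i → Σℚ (f i))                    ≡⟨ trans (Σℚ-cong (Σℚ≡sum ∘ f)) (Σℚ≡sum (λ i → ℚΣ.sum (f i))) ⟩
    ℚΣ.sum (λ i → ℚΣ.sum (f i))            ≡⟨ ℚΣ.∑-comm f ⟩
    ℚΣ.sum (λ j → ℚΣ.sum (λ i → f i j))    ≡⟨ sym (trans (Σℚ-cong (λ j → Σℚ≡sum (λ i → f i j))) (Σℚ≡sum (λ j → ℚΣ.sum (λ i → f i j)))) ⟩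
    Σℚ (λ j → Σℚ (λ i → f i j))            ∎
    where open ≡-Reasoning

  toℚᵘ-↑ : ∀ z → ℚ.toℚᵘ (↑ z) ℚᵘ.≃ ℚᵘ.mkℚᵘ z 0
  toℚᵘ-↑ z = ℚP.toℚᵘ-fromℚᵘ (ℚᵘ.mkℚᵘ z 0)

  ↑-+ : ∀ a b → ↑ (a ℤ.+ b) ≡ ↑ a + ↑ b
  ↑-+ a b = ℚP.toℚᵘ-injective (begin
    ℚ.toℚᵘ (↑ (a ℤ.+ b))              ≈⟨ toℚᵘ-↑ (a ℤ.+ b) ⟩
    ℚᵘ.mkℚᵘ (a ℤ.+ b) 0               ≈⟨ ℚᵘ.*≡* (cong₂ (λ p q → (p ℤ.+ q) ℤ.* + 1)
                                             (sym (ℤP.*-identityʳ a)) (sym (ℤP.*-identityʳ b))) ⟩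
    ℚᵘ.mkℚᵘ a 0 ℚᵘ.+ ℚᵘ.mkℚᵘ b 0     ≈⟨ ℚᵘP.+-cong (toℚᵘ-↑ a) (toℚᵘ-↑ b) ⟨
    ℚ.toℚᵘ (↑ a) ℚᵘ.+ ℚ.toℚᵘ (↑ b)   ≈⟨ ℚP.toℚᵘ-homo-+ (↑ a) (↑ b) ⟨
    ℚ.toℚᵘ (↑ a + ↑ b)                ∎)
    where open ℚᵘP.≃-Reasoning

  ↑-* : ∀ a b → ↑ (a ℤ.* b) ≡ ↑ a * ↑ b
  ↑-* a b = ℚP.toℚᵘ-injective (begin
    ℚ.toℚᵘ (↑ (a ℤ.* b))              ≈⟨ toℚᵘ-↑ (a ℤ.* b) ⟩
    ℚᵘ.mkℚᵘ a 0 ℚᵘ.* ℚᵘ.mkℚᵘ b 0     ≈⟨ ℚᵘP.*-cong (toℚᵘ-↑ a) (toℚᵘ-↑ b) ⟨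
    ℚ.toℚᵘ (↑ a) ℚᵘ.* ℚ.toℚᵘ (↑ b)   ≈⟨ ℚP.toℚᵘ-homo-* (↑ a) (↑ b) ⟨
    ℚ.toℚᵘ (↑ a * ↑ b)                ∎)
    where open ℚᵘP.≃-Reasoning

  ↑-neg : ∀ a → ↑ (ℤ.- a) ≡ - ↑ a
  ↑-neg a = ℚP.toℚᵘ-injective (begin
    ℚ.toℚᵘ (↑ (ℤ.- a))       ≈⟨ toℚᵘ-↑ (ℤ.- a) ⟩
    ℚᵘ.- ℚᵘ.mkℚᵘ a 0         ≈⟨ ℚᵘP.-‿cong (toℚᵘ-↑ a) ⟨
    ℚᵘ.- ℚ.toℚᵘ (↑ a)        ≈⟨ ℚP.toℚᵘ-homo‿- (↑ a) ⟨
    ℚ.toℚᵘ (- ↑ a)           ∎)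
    where open ℚᵘP.≃-Reasoning

  ↑-injective : ∀ {a b} → ↑ a ≡ ↑ b → a ≡ b
  ↑-injective {a} {b} ↑a≡↑b with ℚᵘP.≃-trans (ℚᵘP.≃-sym (toℚᵘ-↑ a))
                                   (ℚᵘP.≃-trans (ℚP.toℚᵘ-cong ↑a≡↑b) (toℚᵘ-↑ b))
  ... | ℚᵘ.*≡* eq = trans (sym (ℤP.*-identityʳ a)) (trans eq (ℤP.*-identityʳ b))

  ↑-nonNegative⁻¹ : ∀ {z} → 0ℚ ℚ.≤ ↑ z → + 0 ℤ.≤ z
  ↑-nonNegative⁻¹ {z} 0≤↑z with ℚᵘP.≤-respʳ-≃ (toℚᵘ-↑ z) (ℚP.toℚᵘ-mono-≤ 0≤↑z)
  ... | ℚᵘ.*≤* 0≤z*1 = subst (+ 0 ℤ.≤_) (ℤP.*-identityʳ z) 0≤z*1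

  ↑-Σℤ : ∀ {n} (f : Fin n → ℤ) → ↑ (Σℤ f) ≡ Σℚ (↑ ∘ f)
  ↑-Σℤ {ℕ.zero}  f = refl
  ↑-Σℤ {ℕ.suc n} f = trans (↑-+ (f zero) _) (cong (_+_ (↑ (f zero))) (↑-Σℤ (f ∘ suc)))

  +-sum : ∀ {n} (f : Fin n → ℕ) → + ℕΣ.sum f ≡ Σℤ (λ i → + f i)
  +-sum {ℕ.zero}  f = refl
  +-sum {ℕ.suc n} f = trans (ℤP.pos-+ (f zero) (ℕΣ.sum (f ∘ suc))) (cong (ℤ._+_ (+ f zero)) (+-sum (f ∘ suc)))

  IsInt-+ : ∀ {p q} → IsInt p → IsInt q → IsInt (p + q)
  IsInt-+ (a , refl) (b , refl) = a ℤ.+ b , sym (↑-+ a b)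

  IsInt-* : ∀ {p q} → IsInt p → IsInt q → IsInt (p * q)
  IsInt-* (a , refl) (b , refl) = a ℤ.* b , sym (↑-* a b)

  IsInt-Σℚ : ∀ {n} (f : Fin n → ℚ) → (∀ i → IsInt (f i)) → IsInt (Σℚ f)
  IsInt-Σℚ {ℕ.zero}  f _     = + 0 , refl
  IsInt-Σℚ {ℕ.suc n} f f-int = IsInt-+ (f-int zero) (IsInt-Σℚ (f ∘ suc) (f-int ∘ suc))

  δ-diagonal : ∀ {n} (i : Fin n) → δ i i ≡ + 1
  δ-diagonal zero    = refl
  δ-diagonal (suc i) = δ-diagonal i

  ↑δ-nonNegative : ∀ {n} (i l : Fin n) → 0ℚ ℚ.≤ ↑ (δ i l)
  ↑δ-nonNegative zero    zero    = ℚP.nonNegative⁻¹ 1ℚ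
  ↑δ-nonNegative zero    (suc l) = ℚP.≤-refl
  ↑δ-nonNegative (suc i) zero    = ℚP.≤-refl
  ↑δ-nonNegative (suc i) (suc l) = ↑δ-nonNegative i l

  Σℚ-δ : ∀ {n} (i : Fin n) (f : Fin n → ℚ) → Σℚ (λ l → ↑ (δ i l) * f l) ≡ f i
  Σℚ-δ {ℕ.suc n} zero f = begin
    1ℚ * f zero + Σℚ (λ l → 0ℚ * f (suc l))  ≡⟨ cong₂ _+_ (ℚP.*-identityˡ (f zero))
                                                   (trans (Σℚ-cong (λ l → ℚP.*-zeroˡ (f (suc l)))) (Σℚ-zero n)) ⟩
    f zero + 0ℚ                               ≡⟨ ℚP.+-identityʳ (f zero) ⟩
    f zero                                    ∎
    where open ≡-Reasoning
  Σℚ-δ {ℕ.suc n} (suc i) f = begin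
    0ℚ * f zero + Σℚ (λ l → ↑ (δ i l) * f (suc l))  ≡⟨ cong (_+ Σℚ (λ l → ↑ (δ i l) * f (suc l))) (ℚP.*-zeroˡ (f zero)) ⟩
    0ℚ + Σℚ (λ l → ↑ (δ i l) * f (suc l))           ≡⟨ ℚP.+-identityˡ _ ⟩
    Σℚ (λ l → ↑ (δ i l) * f (suc l))                ≡⟨ Σℚ-δ i (f ∘ suc) ⟩
    f (suc i)                                        ∎
    where open ≡-Reasoning

  vertex∈ConvQ : ∀ {n d} (v : Fin n → Fin d → ℤ) (i : Fin n) → ConvQ v (λ q → ↑ (v i q))
  vertex∈ConvQ v i =
    (λ l → ↑ (δ i l)) , ↑δ-nonNegative i
    , trans (Σℚ-cong (λ l → sym (ℚP.*-identityʳ (↑ (δ i l))))) (Σℚ-δ i (λ _ → 1ℚ))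
    , λ q → sym (Σℚ-δ i (λ l → ↑ (v l q)))

  -- Affine forms with integer coefficients

  record AffineForm (d : ℕ) : Set where
    constructor affineForm
    field
      offset : ℤ
      linear : Fin d → ℤ

  open AffineForm

  ⟦_⟧ : ∀ {d} → AffineForm d → (Fin d → ℚ) → ℚ
  ⟦ φ ⟧ x = ↑ (offset φ) + Σℚ (λ q → ↑ (linear φ q) * x q)

  ⟦_⟧ℤ : ∀ {d} → AffineForm d → (Fin d → ℤ) → ℤ
  ⟦ φ ⟧ℤ u = offset φ ℤ.+ Σℤ (λ q → linear φ q ℤ.* u q)

  constᶠ : ∀ {d} → ℤ → AffineForm d
  constᶠ c = affineForm c (λ _ → + 0)

  infixl 6 _⊕_
  infixr 7 _⊛_

  _⊕_ : ∀ {d} → AffineForm d → AffineForm d → AffineForm d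
  φ ⊕ ψ = affineForm (offset φ ℤ.+ offset ψ) (λ q → linear φ q ℤ.+ linear ψ q)

  _⊛_ : ∀ {d} → ℤ → AffineForm d → AffineForm d
  a ⊛ φ = affineForm (a ℤ.* offset φ) (λ q → a ℤ.* linear φ q)

  ⨁ : ∀ {d n} → (Fin n → AffineForm d) → AffineForm d
  ⨁ {n = ℕ.zero}  φ = constᶠ (+ 0)
  ⨁ {n = ℕ.suc n} φ = φ zero ⊕ ⨁ (φ ∘ suc)

  module _ {d : ℕ} where
    open +-*-Solver using (solve; _:+_; _:*_; _:=_)

    ⟦constᶠ⟧ : ∀ c (x : Fin d → ℚ) → ⟦ constᶠ c ⟧ x ≡ ↑ c
    ⟦constᶠ⟧ c x = begin
      ↑ c + Σℚ (λ q → 0ℚ * x q)  ≡⟨ cong (_+_ (↑ c)) (trans (Σℚ-cong (λ q → ℚP.*-zeroˡ (x q))) (Σℚ-zero d)) ⟩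
      ↑ c + 0ℚ                   ≡⟨ ℚP.+-identityʳ (↑ c) ⟩
      ↑ c                        ∎
      where open ≡-Reasoning

    ⟦⊕⟧ : ∀ (φ ψ : AffineForm d) x → ⟦ φ ⊕ ψ ⟧ x ≡ ⟦ φ ⟧ x + ⟦ ψ ⟧ x
    ⟦⊕⟧ φ ψ x = begin
      ↑ (offset φ ℤ.+ offset ψ) + Σℚ (λ q → ↑ (linear φ q ℤ.+ linear ψ q) * x q)
        ≡⟨ cong₂ _+_ (↑-+ (offset φ) (offset ψ)) (Σℚ-cong λ q →
             trans (cong (_* x q) (↑-+ (linear φ q) (linear ψ q))) (ℚP.*-distribʳ-+ (x q) (↑ (linear φ q)) (↑ (linear ψ q)))) ⟩
      (↑ (offset φ) + ↑ (offset ψ)) + Σℚ (λ q → Lφ q + Lψ q)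
        ≡⟨ cong (_+_ (↑ (offset φ) + ↑ (offset ψ))) (Σℚ-distrib-+ Lφ Lψ) ⟩
      (↑ (offset φ) + ↑ (offset ψ)) + (Σℚ Lφ + Σℚ Lψ)
        ≡⟨ solve 4 (λ a b c e → (a :+ b) :+ (c :+ e) := (a :+ c) :+ (b :+ e)) refl
             (↑ (offset φ)) (↑ (offset ψ)) (Σℚ Lφ) (Σℚ Lψ) ⟩
      ⟦ φ ⟧ x + ⟦ ψ ⟧ x ∎
      where
      open ≡-Reasoning
      Lφ Lψ : Fin d → ℚ
      Lφ q = ↑ (linear φ q) * x q
      Lψ q = ↑ (linear ψ q) * x q

    ⟦⊛⟧ : ∀ a (φ : AffineForm d) x → ⟦ a ⊛ φ ⟧ x ≡ ↑ a * ⟦ φ ⟧ x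
    ⟦⊛⟧ a φ x = begin
      ↑ (a ℤ.* offset φ) + Σℚ (λ q → ↑ (a ℤ.* linear φ q) * x q)
        ≡⟨ cong₂ _+_ (↑-* a (offset φ)) (Σℚ-cong λ q →
             trans (cong (_* x q) (↑-* a (linear φ q))) (ℚP.*-assoc (↑ a) _ (x q))) ⟩
      ↑ a * ↑ (offset φ) + Σℚ (λ q → ↑ a * (↑ (linear φ q) * x q))
        ≡⟨ cong (_+_ (↑ a * ↑ (offset φ))) (sym (*-distribˡ-Σℚ (↑ a) (λ q → ↑ (linear φ q) * x q))) ⟩
      ↑ a * ↑ (offset φ) + ↑ a * Σℚ (λ q → ↑ (linear φ q) * x q)
        ≡⟨ sym (ℚP.*-distribˡ-+ (↑ a) _ _) ⟩
      ↑ a * ⟦ φ ⟧ x ∎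
      where open ≡-Reasoning

    ⟦⨁⟧ : ∀ {n} (φ : Fin n → AffineForm d) x → ⟦ ⨁ φ ⟧ x ≡ Σℚ (λ j → ⟦ φ j ⟧ x)
    ⟦⨁⟧ {ℕ.zero}  φ x = ⟦constᶠ⟧ (+ 0) x
    ⟦⨁⟧ {ℕ.suc n} φ x = trans (⟦⊕⟧ (φ zero) (⨁ (φ ∘ suc)) x) (cong (_+_ (⟦ φ zero ⟧ x)) (⟦⨁⟧ (φ ∘ suc) x))

    ⟦⟧-lattice : ∀ (φ : AffineForm d) (u : Fin d → ℤ) → ⟦ φ ⟧ (↑ ∘ u) ≡ ↑ (⟦ φ ⟧ℤ u)
    ⟦⟧-lattice φ u = sym (begin
      ↑ (offset φ ℤ.+ Σℤ (λ q → linear φ q ℤ.* u q))       ≡⟨ ↑-+ (offset φ) _ ⟩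
      ↑ (offset φ) + ↑ (Σℤ (λ q → linear φ q ℤ.* u q))     ≡⟨ cong (_+_ (↑ (offset φ))) (↑-Σℤ (λ q → linear φ q ℤ.* u q)) ⟩
      ↑ (offset φ) + Σℚ (λ q → ↑ (linear φ q ℤ.* u q))     ≡⟨ cong (_+_ (↑ (offset φ))) (Σℚ-cong (λ q → ↑-* (linear φ q) (u q))) ⟩
      ⟦ φ ⟧ (↑ ∘ u)                                        ∎)
      where open ≡-Reasoning

    Σ-weighted-⟦⟧ : ∀ {n} (φ : AffineForm d) (v : Fin n → Fin d → ℤ) (s : Fin n → ℚ) →
      Σℚ (λ i → s i * ⟦ φ ⟧ (λ q → ↑ (v i q))) ≡
      ↑ (offset φ) * Σℚ s + Σℚ (λ q → ↑ (linear φ q) * Σℚ (λ i → s i * ↑ (v i q)))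
    Σ-weighted-⟦⟧ φ v s = begin
      Σℚ (λ i → s i * (c + Σℚ (λ q → L q * V i q)))
        ≡⟨ Σℚ-cong (λ i → ℚP.*-distribˡ-+ (s i) c _) ⟩
      Σℚ (λ i → s i * c + s i * Σℚ (λ q → L q * V i q))
        ≡⟨ Σℚ-distrib-+ (λ i → s i * c) _ ⟩
      Σℚ (λ i → s i * c) + Σℚ (λ i → s i * Σℚ (λ q → L q * V i q))
        ≡⟨ cong₂ _+_ (trans (Σℚ-cong (λ i → ℚP.*-comm (s i) c)) (sym (*-distribˡ-Σℚ c s)))
                     (Σℚ-cong (λ i → *-distribˡ-Σℚ (s i) (λ q → L q * V i q))) ⟩
      c * Σℚ s + Σℚ (λ i → Σℚ (λ q → s i * (L q * V i q)))
        ≡⟨ cong (_+_ (c * Σℚ s)) (Σℚ-comm (λ i q → s i * (L q * V i q))) ⟩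
      c * Σℚ s + Σℚ (λ q → Σℚ (λ i → s i * (L q * V i q)))
        ≡⟨ cong (_+_ (c * Σℚ s)) (Σℚ-cong (λ q → trans
             (Σℚ-cong (λ i → solve 3 (λ a b e → a :* (b :* e) := b :* (a :* e)) refl (s i) (L q) (V i q)))
             (sym (*-distribˡ-Σℚ (L q) (λ i → s i * V i q))))) ⟩
      c * Σℚ s + Σℚ (λ q → L q * Σℚ (λ i → s i * V i q)) ∎
      where
      open ≡-Reasoning
      c = ↑ (offset φ)
      L = λ q → ↑ (linear φ q)
      V = λ i q → ↑ (v i q)

  ⟦⟧-affineCombination : ∀ {n d} (φ : AffineForm d) (v : Fin n → Fin d → ℤ) (s : Fin n → ℚ) x →
    Σℚ s ≡ 1ℚ → (∀ q → x q ≡ Σℚ (λ i → s i * ↑ (v i q))) →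
    ⟦ φ ⟧ x ≡ Σℚ (λ i → s i * ⟦ φ ⟧ (λ q → ↑ (v i q)))
  ⟦⟧-affineCombination φ v s x Σs≡1 x≡Σsv = begin
    ↑ (offset φ) + Σℚ (λ q → ↑ (linear φ q) * x q)
      ≡⟨ cong₂ _+_ (sym (trans (cong (↑ (offset φ) *_) Σs≡1) (ℚP.*-identityʳ (↑ (offset φ)))))
                   (Σℚ-cong (λ q → cong (↑ (linear φ q) *_) (x≡Σsv q))) ⟩
    ↑ (offset φ) * Σℚ s + Σℚ (λ q → ↑ (linear φ q) * Σℚ (λ i → s i * ↑ (v i q)))
      ≡⟨ sym (Σ-weighted-⟦⟧ φ v s) ⟩
    Σℚ (λ i → s i * ⟦ φ ⟧ (λ q → ↑ (v i q))) ∎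
    where open ≡-Reasoning

  -- Barycentric coordinates and the Cayley partition

  Σℚ-relative : ∀ {m} (t a : Fin (ℕ.suc m) → ℚ) → Σℚ t ≡ 1ℚ →
    Σℚ (λ l → t l * a l) + - a zero ≡ Σℚ (λ l → t (suc l) * (a (suc l) + - a zero))
  Σℚ-relative t a Σt≡1 = begin
    (t zero * a zero + S) + - a zero
      ≡⟨ solve 4 (λ t₀ a₀ s τ → (t₀ :* a₀ :+ s) :+ (:- a₀) := (s :+ (:- (τ :* a₀))) :+ (t₀ :+ τ :+ (:- con 1ℚ)) :* a₀)
           refl (t zero) (a zero) S T ⟩
    (S + - (T * a zero)) + (t zero + T + - 1ℚ) * a zero
      ≡⟨ cong (λ τ → (S + - (T * a zero)) + (τ + - 1ℚ) * a zero) Σt≡1 ⟩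
    (S + - (T * a zero)) + (1ℚ + - 1ℚ) * a zero
      ≡⟨ solve 3 (λ s τ a₀ → (s :+ (:- (τ :* a₀))) :+ (con 1ℚ :+ (:- con 1ℚ)) :* a₀ := s :+ (:- con 1ℚ) :* (τ :* a₀))
           refl S T (a zero) ⟩
    S + - 1ℚ * (T * a zero)
      ≡⟨ cong (λ z → S + - 1ℚ * z) (trans (ℚP.*-comm T (a zero)) (*-distribˡ-Σℚ (a zero) (t ∘ suc))) ⟩
    S + - 1ℚ * Σℚ (λ l → a zero * t (suc l))
      ≡⟨ cong (_+_ S) (*-distribˡ-Σℚ (- 1ℚ) (λ l → a zero * t (suc l))) ⟩
    S + Σℚ (λ l → - 1ℚ * (a zero * t (suc l)))
      ≡⟨ sym (Σℚ-distrib-+ (λ l → t (suc l) * a (suc l)) _) ⟩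
    Σℚ (λ l → t (suc l) * a (suc l) + - 1ℚ * (a zero * t (suc l)))
      ≡⟨ Σℚ-cong (λ l → solve 3 (λ τ α a₀ → τ :* α :+ (:- con 1ℚ) :* (a₀ :* τ) := τ :* (α :+ (:- a₀)))
           refl (t (suc l)) (a (suc l)) (a zero)) ⟩
    Σℚ (λ l → t (suc l) * (a (suc l) + - a zero)) ∎
    where
    open ≡-Reasoning
    open +-*-Solver using (solve; _:+_; _:*_; :-_; _:=_; con)
    S = Σℚ (λ l → t (suc l) * a (suc l))
    T = Σℚ (t ∘ suc)

  Σℚ-leftInverse : ∀ {m} (V U : Fin m → Fin m → ℤ) →
    (∀ i k → Σℤ (λ j → V i j ℤ.* U j k) ≡ δ i k) →
    ∀ (t : Fin m → ℚ) i → Σℚ (λ p → ↑ (V i p) * Σℚ (λ l → t l * ↑ (U p l))) ≡ t i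
  Σℚ-leftInverse V U VU≡I t i = begin
    Σℚ (λ p → ↑ (V i p) * Σℚ (λ l → t l * ↑ (U p l)))
      ≡⟨ Σℚ-cong (λ p → *-distribˡ-Σℚ (↑ (V i p)) (λ l → t l * ↑ (U p l))) ⟩
    Σℚ (λ p → Σℚ (λ l → ↑ (V i p) * (t l * ↑ (U p l))))
      ≡⟨ Σℚ-comm (λ p l → ↑ (V i p) * (t l * ↑ (U p l))) ⟩
    Σℚ (λ l → Σℚ (λ p → ↑ (V i p) * (t l * ↑ (U p l))))
      ≡⟨ Σℚ-cong (λ l → Σℚ-cong (λ p → solve 3 (λ a τ u → a :* (τ :* u) := τ :* (a :* u)) refl (↑ (V i p)) (t l) (↑ (U p l)))) ⟩
    Σℚ (λ l → Σℚ (λ p → t l * (↑ (V i p) * ↑ (U p l))))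
      ≡⟨ Σℚ-cong (λ l → sym (*-distribˡ-Σℚ (t l) (λ p → ↑ (V i p) * ↑ (U p l)))) ⟩
    Σℚ (λ l → t l * Σℚ (λ p → ↑ (V i p) * ↑ (U p l)))
      ≡⟨ Σℚ-cong (λ l → cong (t l *_) (begin
           Σℚ (λ p → ↑ (V i p) * ↑ (U p l))   ≡⟨ Σℚ-cong (λ p → sym (↑-* (V i p) (U p l))) ⟩
           Σℚ (λ p → ↑ (V i p ℤ.* U p l))     ≡⟨ sym (↑-Σℤ (λ p → V i p ℤ.* U p l)) ⟩
           ↑ (Σℤ (λ p → V i p ℤ.* U p l))     ≡⟨ cong ↑ (VU≡I i l) ⟩
           ↑ (δ i l)                          ∎)) ⟩
    Σℚ (λ l → t l * ↑ (δ i l))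
      ≡⟨ trans (Σℚ-cong (λ l → ℚP.*-comm (t l) (↑ (δ i l)))) (Σℚ-δ i t) ⟩
    t i ∎
    where
    open ≡-Reasoning
    open +-*-Solver using (solve; _:*_; _:=_)

  -- barycentric k x is the k-th barycentric coordinate of affMap A b x with respect to w; its
  -- coefficients are integers because V inverts the edge matrix of w over ℤ.
  module Barycentric {d m} (A : Fin m → Fin d → ℤ) (b : Fin m → ℤ)
    (w : Fin (ℕ.suc m) → Fin m → ℤ) (V : Fin m → Fin m → ℤ)
    (V·U≡I : ∀ i k → Σℤ (λ j → V i j ℤ.* (w (suc k) j ℤ.- w zero j)) ≡ δ i k) where

    open +-*-Solver using (solve; _:+_; _:*_; :-_; _:=_; con)

    relativeTerm : Fin m → Fin m → AffineForm d
    relativeTerm j p = V j p ⊛ (affineForm (b p) (A p) ⊕ constᶠ (ℤ.- w zero p))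

    relative : Fin m → AffineForm d
    relative j = ⨁ (relativeTerm j)

    barycentric : Fin (ℕ.suc m) → AffineForm d
    barycentric zero    = constᶠ (+ 1) ⊕ (ℤ.- + 1) ⊛ ⨁ relative
    barycentric (suc j) = relative j

    ⟦relative⟧ : ∀ j x → ⟦ relative j ⟧ x ≡ Σℚ (λ p → ↑ (V j p) * (affMap A b x p + - ↑ (w zero p)))
    ⟦relative⟧ j x = trans (⟦⨁⟧ (relativeTerm j) x) (Σℚ-cong λ p → begin
      ⟦ relativeTerm j p ⟧ x
        ≡⟨ ⟦⊛⟧ (V j p) (affineForm (b p) (A p) ⊕ constᶠ (ℤ.- w zero p)) x ⟩
      ↑ (V j p) * ⟦ affineForm (b p) (A p) ⊕ constᶠ (ℤ.- w zero p) ⟧ x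
        ≡⟨ cong (↑ (V j p) *_) (⟦⊕⟧ (affineForm (b p) (A p)) (constᶠ (ℤ.- w zero p)) x) ⟩
      ↑ (V j p) * (affMap A b x p + ⟦ constᶠ (ℤ.- w zero p) ⟧ x)
        ≡⟨ cong (λ z → ↑ (V j p) * (affMap A b x p + z)) (trans (⟦constᶠ⟧ (ℤ.- w zero p) x) (↑-neg (w zero p))) ⟩
      ↑ (V j p) * (affMap A b x p + - ↑ (w zero p)) ∎)
      where open ≡-Reasoning

    ⟦barycentric-zero⟧ : ∀ x → ⟦ barycentric zero ⟧ x ≡ 1ℚ + - 1ℚ * Σℚ (λ j → ⟦ relative j ⟧ x)
    ⟦barycentric-zero⟧ x = begin
      ⟦ constᶠ (+ 1) ⊕ (ℤ.- + 1) ⊛ ⨁ relative ⟧ x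
        ≡⟨ ⟦⊕⟧ (constᶠ (+ 1)) ((ℤ.- + 1) ⊛ ⨁ relative) x ⟩
      ⟦ constᶠ (+ 1) ⟧ x + ⟦ (ℤ.- + 1) ⊛ ⨁ relative ⟧ x
        ≡⟨ cong₂ _+_ (⟦constᶠ⟧ (+ 1) x) (trans (⟦⊛⟧ (ℤ.- + 1) (⨁ relative) x) (cong (- 1ℚ *_) (⟦⨁⟧ relative x))) ⟩
      1ℚ + - 1ℚ * Σℚ (λ j → ⟦ relative j ⟧ x) ∎
      where open ≡-Reasoning

    Σ-barycentric : ∀ x → Σℚ (λ k → ⟦ barycentric k ⟧ x) ≡ 1ℚ
    Σ-barycentric x = trans (cong (_+ R) (⟦barycentric-zero⟧ x))
      (solve 1 (λ r → (con 1ℚ :+ (:- con 1ℚ) :* r) :+ r := con 1ℚ) refl R)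
      where R = Σℚ (λ j → ⟦ relative j ⟧ x)

    barycentric-coordinates : ∀ x (t : Fin (ℕ.suc m) → ℚ) → Σℚ t ≡ 1ℚ →
      (∀ p → affMap A b x p ≡ Σℚ (λ l → t l * ↑ (w l p))) → ∀ k → ⟦ barycentric k ⟧ x ≡ t k
    barycentric-coordinates x t Σt≡1 x↦t = coordinate
      where
      open ≡-Reasoning
      U : Fin m → Fin m → ℤ
      U p l = w (suc l) p ℤ.- w zero p
      relative-coordinate : ∀ j → ⟦ relative j ⟧ x ≡ t (suc j)
      relative-coordinate j = begin
        ⟦ relative j ⟧ x
          ≡⟨ ⟦relative⟧ j x ⟩
        Σℚ (λ p → ↑ (V j p) * (affMap A b x p + - ↑ (w zero p)))
          ≡⟨ Σℚ-cong (λ p → cong (λ y → ↑ (V j p) * (y + - ↑ (w zero p))) (x↦t p)) ⟩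
        Σℚ (λ p → ↑ (V j p) * (Σℚ (λ l → t l * ↑ (w l p)) + - ↑ (w zero p)))
          ≡⟨ Σℚ-cong (λ p → cong (↑ (V j p) *_) (Σℚ-relative t (λ l → ↑ (w l p)) Σt≡1)) ⟩
        Σℚ (λ p → ↑ (V j p) * Σℚ (λ l → t (suc l) * (↑ (w (suc l) p) + - ↑ (w zero p))))
          ≡⟨ Σℚ-cong (λ p → cong (↑ (V j p) *_) (Σℚ-cong λ l → cong (t (suc l) *_)
               (sym (trans (↑-+ (w (suc l) p) _) (cong (_+_ (↑ (w (suc l) p))) (↑-neg (w zero p))))))) ⟩
        Σℚ (λ p → ↑ (V j p) * Σℚ (λ l → t (suc l) * ↑ (U p l)))
          ≡⟨ Σℚ-leftInverse V U V·U≡I (t ∘ suc) j ⟩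
        t (suc j) ∎
      coordinate : ∀ k → ⟦ barycentric k ⟧ x ≡ t k
      coordinate zero = begin
        ⟦ barycentric zero ⟧ x                     ≡⟨ ⟦barycentric-zero⟧ x ⟩
        1ℚ + - 1ℚ * Σℚ (λ j → ⟦ relative j ⟧ x)   ≡⟨ cong₂ (λ a z → a + - 1ℚ * z) (sym Σt≡1) (Σℚ-cong relative-coordinate) ⟩
        (t zero + T) + - 1ℚ * T                    ≡⟨ solve 2 (λ a τ → (a :+ τ) :+ (:- con 1ℚ) :* τ := a) refl (t zero) T ⟩
        t zero                                     ∎
        where T = Σℚ (t ∘ suc)
      coordinate (suc j) = relative-coordinate j

    barycentric-vertex : ∀ x k → (∀ p → affMap A b x p ≡ ↑ (w k p)) → ⟦ barycentric k ⟧ x ≡ 1ℚ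
    barycentric-vertex x k x↦wₖ =
      let (t , _ , Σt≡1 , wₖ≡Σtw) = vertex∈ConvQ w k
      in trans (barycentric-coordinates x t Σt≡1 (λ p → trans (x↦wₖ p) (wₖ≡Σtw p)) k) (cong ↑ (δ-diagonal k))

  -- part k i = 1 iff the projection maps the vertex i to the vertex k of the unimodular simplex.
  record CayleyPartition {n d} (v : Fin n → Fin d → ℤ) (ℓ : ℕ) : Set where
    field
      part       : Fin ℓ → Fin n → ℕ
      covers     : ∀ i → ℕΣ.sum (λ k → part k i) ≡ 1
      nonempty   : ∀ k → ¬ (∀ i → part k i ≡ 0)
      Λ-integral : ∀ x → InΛ v x → ∀ k → IsInt (Σℚ (λ i → x i * ↑ (+ part k i)))

  cayleyPartition : ∀ {n d m} (v : Fin n → Fin d → ℤ) →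
    ProjectsOntoUnimodularSimplex v m → CayleyPartition v (ℕ.suc m)
  cayleyPartition {n} {d} {m} v (A , b , w , (V , _ , V·U≡I) , image) = record
    { part       = part
    ; covers     = covers
    ; nonempty   = nonempty
    ; Λ-integral = Λ-integral
    }
    where
    open Barycentric A b w V V·U≡I
    open ≡-Reasoning

    vertex : Fin n → Fin d → ℚ
    vertex i q = ↑ (v i q)

    label : Fin (ℕ.suc m) → Fin n → ℤ
    label k i = ⟦ barycentric k ⟧ℤ (v i)

    ↑label : ∀ k i → ↑ (label k i) ≡ ⟦ barycentric k ⟧ (vertex i)
    ↑label k i = sym (⟦⟧-lattice (barycentric k) (v i))

    label-nonNegative : ∀ k i → + 0 ℤ.≤ label k i
    label-nonNegative k i with proj₁ (image (affMap A b (vertex i))) (vertex i , vertex∈ConvQ v i , λ _ → refl)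
    ... | t , t≥0 , Σt≡1 , vertex↦t = ↑-nonNegative⁻¹
      (subst (0ℚ ℚ.≤_) (trans (sym (barycentric-coordinates (vertex i) t Σt≡1 vertex↦t k)) (sym (↑label k i))) (t≥0 k))

    part : Fin (ℕ.suc m) → Fin n → ℕ
    part k i = ℤ.∣ label k i ∣

    +part : ∀ k i → + part k i ≡ label k i
    +part k i = ℤP.0≤i⇒+∣i∣≡i (label-nonNegative k i)

    covers : ∀ i → ℕΣ.sum (λ k → part k i) ≡ 1
    covers i = ℤP.+-injective (↑-injective (begin
      ↑ (+ ℕΣ.sum (λ k → part k i))             ≡⟨ cong ↑ (+-sum (λ k → part k i)) ⟩
      ↑ (Σℤ (λ k → + part k i))                 ≡⟨ ↑-Σℤ (λ k → + part k i) ⟩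
      Σℚ (λ k → ↑ (+ part k i))                 ≡⟨ Σℚ-cong (λ k → trans (cong ↑ (+part k i)) (↑label k i)) ⟩
      Σℚ (λ k → ⟦ barycentric k ⟧ (vertex i))   ≡⟨ Σ-barycentric (vertex i) ⟩
      1ℚ                                         ∎))

    nonempty : ∀ k → ¬ (∀ i → part k i ≡ 0)
    nonempty k part≡0 with proj₂ (image (λ p → ↑ (w k p))) (vertex∈ConvQ w k)
    ... | x , (s , _ , Σs≡1 , x≡Σsv) , x↦wₖ = ℚP.1≢0 (begin
      1ℚ                                              ≡⟨ sym (barycentric-vertex x k x↦wₖ) ⟩
      ⟦ barycentric k ⟧ x                             ≡⟨ ⟦⟧-affineCombination (barycentric k) v s x Σs≡1 x≡Σsv ⟩
      Σℚ (λ i → s i * ⟦ barycentric k ⟧ (vertex i))   ≡⟨ Σℚ-cong (λ i → cong (s i *_)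
                                                           (trans (sym (↑label k i)) (cong ↑ (trans (sym (+part k i)) (cong +_ (part≡0 i)))))) ⟩
      Σℚ (λ i → s i * 0ℚ)                             ≡⟨ trans (Σℚ-cong (λ i → ℚP.*-zeroʳ (s i))) (Σℚ-zero n) ⟩
      0ℚ                                              ∎)

    Λ-integral : ∀ x → InΛ v x → ∀ k → IsInt (Σℚ (λ i → x i * ↑ (+ part k i)))
    Λ-integral x (Σxv-integral , Σx-integral) k = subst IsInt (sym (begin
      Σℚ (λ i → x i * ↑ (+ part k i))
        ≡⟨ Σℚ-cong (λ i → cong (x i *_) (trans (cong ↑ (+part k i)) (↑label k i))) ⟩
      Σℚ (λ i → x i * ⟦ φ ⟧ (vertex i))
        ≡⟨ Σ-weighted-⟦⟧ φ v x ⟩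
      ↑ (offset φ) * Σℚ x + Σℚ (λ q → ↑ (linear φ q) * Σℚ (λ i → x i * ↑ (v i q))) ∎))
      (IsInt-+ (IsInt-* (offset φ , refl) Σx-integral)
               (IsInt-Σℚ _ (λ q → IsInt-* (linear φ q , refl) (Σxv-integral q))))
      where φ = barycentric k

  /2≡*½ : ∀ a → (+ a) ℚ./ 2 ≡ ↑ (+ a) * ℚ.½
  /2≡*½ a = ℚP.toℚᵘ-injective (begin
    ℚ.toℚᵘ ((+ a) ℚ./ 2)                    ≈⟨ ℚP.toℚᵘ-fromℚᵘ (ℚᵘ.mkℚᵘ (+ a) 1) ⟩
    ℚᵘ.mkℚᵘ (+ a) 1                         ≈⟨ ℚᵘ.*≡* (cong (ℤ._* + 2) (ℤP.*-identityʳ (+ a))) ⟨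
    ℚᵘ.mkℚᵘ (+ a) 0 ℚᵘ.* ℚᵘ.mkℚᵘ (+ 1) 1   ≈⟨ ℚᵘP.*-cong (toℚᵘ-↑ (+ a)) (ℚP.toℚᵘ-fromℚᵘ (ℚᵘ.mkℚᵘ (+ 1) 1)) ⟨
    ℚ.toℚᵘ (↑ (+ a)) ℚᵘ.* ℚ.toℚᵘ ℚ.½        ≈⟨ ℚP.toℚᵘ-homo-* (↑ (+ a)) ℚ.½ ⟨
    ℚ.toℚᵘ (↑ (+ a) * ℚ.½)                  ∎)
    where open ℚᵘP.≃-Reasoning

  Σℚ-halves : ∀ {n} (g f : Fin n → ℕ) →
    Σℚ (λ c → (+ g c) ℚ./ 2 * ↑ (+ f c)) ≡ ↑ (+ ℕΣ.sum (λ c → g c ℕ.* f c)) * ℚ.½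
  Σℚ-halves g f = begin
    Σℚ (λ c → (+ g c) ℚ./ 2 * ↑ (+ f c))
      ≡⟨ Σℚ-cong (λ c → begin
           (+ g c) ℚ./ 2 * ↑ (+ f c)       ≡⟨ cong (_* ↑ (+ f c)) (/2≡*½ (g c)) ⟩
           ↑ (+ g c) * ℚ.½ * ↑ (+ f c)     ≡⟨ solve 3 (λ a h e → a :* h :* e := h :* (a :* e)) refl (↑ (+ g c)) ℚ.½ (↑ (+ f c)) ⟩
           ℚ.½ * (↑ (+ g c) * ↑ (+ f c))   ≡⟨ cong (ℚ.½ *_) (sym (trans (cong ↑ (ℤP.pos-* (g c) (f c))) (↑-* (+ g c) (+ f c)))) ⟩
           ℚ.½ * ↑ (+ (g c ℕ.* f c))       ∎) ⟩
    Σℚ (λ c → ℚ.½ * ↑ (+ (g c ℕ.* f c)))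
      ≡⟨ sym (*-distribˡ-Σℚ ℚ.½ (λ c → ↑ (+ (g c ℕ.* f c)))) ⟩
    ℚ.½ * Σℚ (λ c → ↑ (+ (g c ℕ.* f c)))
      ≡⟨ cong (ℚ.½ *_) (sym (trans (cong ↑ (+-sum (λ c → g c ℕ.* f c))) (↑-Σℤ (λ c → + (g c ℕ.* f c))))) ⟩
    ℚ.½ * ↑ (+ ℕΣ.sum (λ c → g c ℕ.* f c))
      ≡⟨ ℚP.*-comm ℚ.½ (↑ (+ ℕΣ.sum (λ c → g c ℕ.* f c))) ⟩
    ↑ (+ ℕΣ.sum (λ c → g c ℕ.* f c)) * ℚ.½ ∎
    where
    open ≡-Reasoning
    open +-*-Solver using (solve; _:*_; _:=_)

  IsInt-half⇒even : ∀ a → IsInt (↑ (+ a) * ℚ.½) → 2 ∣ a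
  IsInt-half⇒even a (z , a/2≡z) = divides ℤ.∣ z ∣ (trans (cong ℤ.∣_∣ a≡z*2) (ℤP.abs-* z (+ 2)))
    where
    a≡z*2 : + a ≡ z ℤ.* + 2
    a≡z*2 = ↑-injective (begin
      ↑ (+ a)                   ≡⟨ sym (ℚP.*-identityʳ (↑ (+ a))) ⟩
      ↑ (+ a) * (ℚ.½ * ↑ (+ 2)) ≡⟨ sym (ℚP.*-assoc (↑ (+ a)) ℚ.½ (↑ (+ 2))) ⟩
      ↑ (+ a) * ℚ.½ * ↑ (+ 2)   ≡⟨ cong (_* ↑ (+ 2)) a/2≡z ⟩
      ↑ z * ↑ (+ 2)             ≡⟨ sym (↑-* z (+ 2)) ⟩
      ↑ (z ℤ.* + 2)             ∎)
      where open ≡-Reasoning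

  row∈B : ∀ K (j : Fin K) → InB K (M K j)
  row∈B K j = δ j , λ c → + 0 , (begin
    M K j c - Σℚ (λ j′ → ↑ (δ j j′) * M K j′ c)   ≡⟨ cong (_-_ (M K j c)) (Σℚ-δ j (λ j′ → M K j′ c)) ⟩
    M K j c - M K j c                              ≡⟨ ℚP.+-inverseʳ (M K j c) ⟩
    0ℚ                                             ∎)
    where open ≡-Reasoning


open import Defs
open import Data.Nat using (ℕ; _+_; _^_; _∸_; _≤_)
open import Data.Nat.DivMod using (_/_)
open import Data.Integer using (ℤ)
open import Data.Rational using (ℚ)
open import Data.Fin using (Fin)
open import Data.Product using (_×_)

open import Data.Nat using (suc; _*_; _<_; NonZero; s≤s; z≤n)
open import Data.Nat.DivMod using (m*n/n≡m; /-monoˡ-≤)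
open import Data.Fin using (toℕ)
open import Data.Product using (proj₂)
open import Relation.Binary.PropositionalEquality using (subst)
open ColumnPartitions
open CayleyStructure

m*o≤n⇒m≤n/o : ∀ {m n} o .{{_ : NonZero o}} → m * o ≤ n → m ≤ n / o
m*o≤n⇒m≤n/o {m} o m*o≤n = subst (_≤ _) (m*n/n≡m m o) (/-monoˡ-≤ o m*o≤n)

2^K∸1<2^K : ∀ K → 2 ^ K ∸ 1 < 2 ^ K
2^K∸1<2^K K = ℕP.∸-monoʳ-< (s≤s z≤n) (ℕP.m^n>0 2 K)

lemma5p2 : (r : ℕ) (v : Fin (2 ^ (r + 2) ∸ 1) → Fin (2 ^ (r + 2) ∸ 2) → ℤ) →
    IsLatticeSimplex v →
    (∀ (x : Fin (2 ^ (r + 2) ∸ 1) → ℚ) → (InΛ v x → InB (r + 2) x) × (InB (r + 2) x → InΛ v x)) →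
    (ℓ : ℕ) → IsCayleyOfLength v ℓ → ℓ ≤ (2 ^ (r + 2) ∸ 1) / 3
lemma5p2 r v _ Λ≡B 0       ()
lemma5p2 r v _ Λ≡B (suc m) projection =
  m*o≤n⇒m≤n/o 3 (partition-size part covers λ k →
    evenColumnSums⇒3≤sum K (2^K∸1<2^K K) (part k) (part≤1 k) (evenColumnSums k) (nonempty k))
  where
  open CayleyPartition (cayleyPartition v projection)
  K = r + 2
  part≤1 : ∀ k i → part k i ≤ 1
  part≤1 k i = subst (part k i ≤_) (covers i) (≤-sum (λ k′ → part k′ i) k)
  evenColumnSums : ∀ k → EvenColumnSums K (part k)
  evenColumnSums k j = IsInt-half⇒even (ℕΣ.sum (λ c → bit (toℕ j) (suc (toℕ c)) * part k c))
    (subst IsInt (Σℚ-halves (λ c → bit (toℕ j) (suc (toℕ c))) (part k))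
      (Λ-integral (M K j) (proj₂ (Λ≡B (M K j)) (row∈B K j)) k))
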